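{- Let $i$ be a non-source vertex of $G$ with predecessors $i'$ and $i''$, and let $1\le j\le m$. (1) There is a regular tree-like resolution derivation of the clause $\overline{p}_{i,j}\lor r_j$ from clauses of $\mathrm{Stone}(G,m)$ together with the clauses $\overline{p}_{i',j'}\lor r_{j'}$ and $\overline{p}_{i'',j''}\lor r_{j''}$ ($1\le j',j''\le m$), which has size $O(m^2)$ and uses as resolution variables only the variables $r_k$ for $k\neq j$ and the variables $p_{i',k}$ and $p_{i'',k}$ for $1\le k\le m$. (2) In the setting of a regRTI proof being built, if $i'$ and $i''$ are 3-learned and $\overline{p}_{i,j}\lor r_j$ is already $K$-learned for some $K<3$, then there is a regular tree-like derivation of $\overline{p}_{i,j}\lor r_j$ from learned clauses (including clauses of $\mathrm{Stone}(G,m)$) whose inclusion causes $\overline{p}_{i,j}\lor r_j$ to become $(K+1)$-learned; this derivation has size $O(m^2)$ and uses as resolution variables at most the variables $r_k$ for $k\ne j$ and $p_{i',k}$, $p_{i'',k}$ for all $k$.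
   Context: Let $G=(V,E)$ be a dag with vertices $V=\{1,\dots,N\}$, single sink $1$, every non-source vertex of in-degree $2$, edges going from larger to smaller numbers, and sources exactly $n+1,\dots,N$; let $m\ge N$. $\mathrm{Stone}(G,m)$ is the clause set over variables $p_{i,j}$, $r_j$ consisting of: $\bigvee_{j=1}^m p_{i,j}$ for each vertex $i$; $\overline{p}_{i,j}\lor r_j$ for each source $i$ and each $j$; $\overline{p}_{1,j}\lor\overline{r}_j$ for each $j$; and $\overline{p}_{i',j'}\lor\overline{r}_{j'}\lor\overline{p}_{i'',j''}\lor\overline{r}_{j''}\lor\overline{p}_{i,j}\lor r_j$ whenever $i',i''$ are the two predecessors of $i$ and $j\notin\{j',j''\}$. A derivation is regular if no variable is resolved on twice along any path; size is number of clauses; constants in $O$ are absolute. regRTI setting: a regRTI derivation is a tree-like resolution derivation, regular, whose leaves are clauses of $\mathrm{Stone}(G,m)$ or clauses derived earlier in the tree's postorder (left subtree before right subtree before node) by an input subderivation (every inference having a hypothesis that is an initial clause or such a lemma). At a given point in constructing such a proof, a clause is learned if it is in $\mathrm{Stone}(G,m)$ or has been derived by an input subderivation earlier in postorder. Let $i$ be non-source with predecessors $i',i''$ such that all $\overline{p}_{i',j'}\lor r_{j'}$ and $\overline{p}_{i'',j''}\lor r_{j''}$ are learned. Then $\overline{p}_{i,j}\lor r_j$ is 3-learned if it is learned; 2-learned if all clauses $\overline{p}_{i'',j''}\lor\overline{p}_{i,j}\lor r_j$ with $j''\ne j$ are learned; 1-learned if all clauses $\overline{p}_{i',j'}\lor\overline{p}_{i'',j''}\lor\overline{p}_{i,j}\lor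 r_j$ with $j'\ne j$, $j''\ne j$ are learned; every such clause is 0-learned. A vertex $i$ is $K$-learned if every $\overline{p}_{i,j}\lor r_j$ ($1\le j\le m$) is $K$-learned; source vertices are 3-learned. -}

module Defs where

open import Data.Nat using (ℕ; zero; suc; _+_; _*_; _≤_; _<_)
open import Data.Bool using (Bool; true; false; not)
open import Data.Product using (Σ; ∃; _×_; _,_)
open import Data.Sum using (_⊎_)
open import Data.Unit using (⊤)
open import Data.List using (List; []; _∷_; applyUpTo)
open import Data.List.Membership.Propositional using (_∈_; _∉_)
open import Data.List.Relation.Unary.All using (All)
open import Relation.Binary.PropositionalEquality using (_≡_; _≢_)
open import Relation.Nullary using (¬_)

-- Vertices are 1..N; the non-sources are exactly 1..n, each
-- with two distinct predecessors pred₁ i (= i') and pred₂ i (= i''),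
-- both larger than i; vertices n+1..N have no predecessors (sources).
-- Single sink 1: every vertex 2..N is a predecessor of some non-source
-- (vertex 1 has no successor since edges decrease).

record DAG : Set where
  field
    N n   : ℕ
    1≤N   : 1 ≤ N
    n≤N   : n ≤ N
    pred₁ pred₂ : ℕ → ℕ
    pred₁-range : ∀ i → 1 ≤ i → i ≤ n → i < pred₁ i × pred₁ i ≤ N
    pred₂-range : ∀ i → 1 ≤ i → i ≤ n → i < pred₂ i × pred₂ i ≤ N
    pred-distinct : ∀ i → 1 ≤ i → i ≤ n → pred₁ i ≢ pred₂ i
    single-sink : ∀ v → 2 ≤ v → v ≤ N →
      ∃ λ i → 1 ≤ i × i ≤ n × (pred₁ i ≡ v ⊎ pred₂ i ≡ v)

-- Variables, literals, clauses (clauses are lists read as sets).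

data Var : Set where
  p : ℕ → ℕ → Var
  r : ℕ → Var

Lit : Set
Lit = Var × Bool

pos neg : Var → Lit
pos v = v , true
neg v = v , false

Clause : Set
Clause = List Lit

ClauseSet : Set₁
ClauseSet = Clause → Set

_≋_ : Clause → Clause → Set
C ≋ D = ∀ l → (l ∈ C → l ∈ D) × (l ∈ D → l ∈ C)

_∈ₛ_ : Clause → ClauseSet → Set
C ∈ₛ S = ∃ λ C' → S C' × (C ≋ C')

_∪ₛ_ : ClauseSet → ClauseSet → ClauseSet
(S ∪ₛ T) C = S C ⊎ T C

module _ (G : DAG) (m : ℕ) where
  open DAG G

  data Stone : ClauseSet where
    wide : ∀ i → 1 ≤ i → i ≤ N →
      Stone (applyUpTo (λ k → pos (p i (suc k))) m)
    source : ∀ i j → n < i → i ≤ N → 1 ≤ j → j ≤ m →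
      Stone (neg (p i j) ∷ pos (r j) ∷ [])
    sink : ∀ j → 1 ≤ j → j ≤ m →
      Stone (neg (p 1 j) ∷ neg (r j) ∷ [])
    pebbling : ∀ i j' j'' j → 1 ≤ i → i ≤ n →
      1 ≤ j' → j' ≤ m → 1 ≤ j'' → j'' ≤ m → 1 ≤ j → j ≤ m →
      j ≢ j' → j ≢ j'' →
      Stone (neg (p (pred₁ i) j') ∷ neg (r j') ∷ neg (p (pred₂ i) j'') ∷ neg (r j'')
             ∷ neg (p i j) ∷ pos (r j) ∷ [])

  target : ℕ → ℕ → Clause
  target v k = neg (p v k) ∷ pos (r k) ∷ []

  Allowed : ℕ → ℕ → Var → Set
  Allowed i j v =
    (∃ λ k → 1 ≤ k × k ≤ m × k ≢ j × v ≡ r k) ⊎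
    (∃ λ k → 1 ≤ k × k ≤ m × (v ≡ p (pred₁ i) k ⊎ v ≡ p (pred₂ i) k))

IsResolvent : Var → Bool → Clause → Clause → Clause → Set
IsResolvent v b C D E = ∀ l →
  (l ∈ E → (l ∈ C × l ≢ (v , b)) ⊎ (l ∈ D × l ≢ (v , not b))) ×
  ((l ∈ C × l ≢ (v , b)) ⊎ (l ∈ D × l ≢ (v , not b)) → l ∈ E)

data Deriv (H : ClauseSet) : Clause → Set where
  leaf : ∀ {C} → C ∈ₛ H → Deriv H C
  res  : ∀ {C D E} (v : Var) (b : Bool) → Deriv H C → Deriv H D →
         (v , b) ∈ C → (v , not b) ∈ D → IsResolvent v b C D E → Deriv H E

module _ {H : ClauseSet} where

  size : ∀ {C} → Deriv H C → ℕ
  size (leaf _) = 1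
  size (res _ _ d₁ d₂ _ _ _) = suc (size d₁ + size d₂)

  resVars : ∀ {C} → Deriv H C → List Var
  resVars (leaf _) = []
  resVars (res v _ d₁ d₂ _ _ _) = v ∷ (resVars d₁ Data.List.++ resVars d₂)

  Regular : ∀ {C} → Deriv H C → Set
  Regular (leaf _) = ⊤
  Regular (res v _ d₁ d₂ _ _ _) =
    v ∉ resVars d₁ × v ∉ resVars d₂ × Regular d₁ × Regular d₂

  IsLeaf : ∀ {C} → Deriv H C → Set
  IsLeaf (leaf _) = ⊤
  IsLeaf (res _ _ _ _ _ _ _) = Data.Empty.⊥
    where import Data.Empty

  Input : ∀ {C} → Deriv H C → Set
  Input (leaf _) = ⊤
  Input (res _ _ d₁ d₂ _ _ _) = (IsLeaf d₁ ⊎ IsLeaf d₂) × Input d₁ × Input d₂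

  inputLemmas : ∀ {C} → Deriv H C → ClauseSet
  inputLemmas {C} (leaf _) E = C ≡ E
  inputLemmas {C} d@(res _ _ d₁ d₂ _ _ _) E =
    (Input d × C ≡ E) ⊎ inputLemmas d₁ E ⊎ inputLemmas d₂ E

-- The regRTI setting: sets of learned clauses reachable while building a
-- regRTI proof.

data Reachable (G : DAG) (m : ℕ) : ClauseSet → Set₁ where
  initial : Reachable G m (Stone G m)
  include : ∀ {L C} (d : Deriv L C) → Regular d → Reachable G m L →
            Reachable G m (L ∪ₛ inputLemmas d)

module _ (G : DAG) (m : ℕ) where
  open DAG G

  Vertex3Learned : ClauseSet → ℕ → Set
  Vertex3Learned L v = n < v ⊎ (∀ k → 1 ≤ k → k ≤ m → target G m v k ∈ₛ L)

  KLearned : ClauseSet → ℕ → ℕ → ℕ → Set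
  KLearned L 0 i j = ⊤
  KLearned L 1 i j = ∀ j' j'' → 1 ≤ j' → j' ≤ m → 1 ≤ j'' → j'' ≤ m →
    j' ≢ j → j'' ≢ j →
    (neg (p (pred₁ i) j') ∷ neg (p (pred₂ i) j'') ∷ neg (p i j) ∷ pos (r j) ∷ []) ∈ₛ L
  KLearned L 2 i j = ∀ j'' → 1 ≤ j'' → j'' ≤ m → j'' ≢ j →
    (neg (p (pred₂ i) j'') ∷ neg (p i j) ∷ pos (r j) ∷ []) ∈ₛ L
  KLearned L (suc (suc (suc _))) i j = target G m i j ∈ₛ L

  PredHyps : ℕ → ClauseSet
  PredHyps i C = ∃ λ k → 1 ≤ k × k ≤ m ×
    (C ≡ target G m (pred₁ i) k ⊎ C ≡ target G m (pred₂ i) k)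

-- The clause is derived in three layers. Resolving a pebbling clause with ¬p_{i′,l} ∨ r_l
-- and ¬p_{i″,k} ∨ r_k (l, k ≠ j) gives C₁ l k = ¬p_{i′,l} ∨ ¬p_{i″,k} ∨ ¬p_{i,j} ∨ r_j.
-- Resolving the wide clause p_{i′,1} ∨ … ∨ p_{i′,m} against C₁ 1 k, …, C₁ m k, with
-- ¬p_{i′,j} ∨ r_j in place of the missing C₁ j k, gives C₂ k = ¬p_{i″,k} ∨ ¬p_{i,j} ∨ r_j;
-- the same elimination on i″ gives ¬p_{i,j} ∨ r_j. Each layer resolves on fresh variables,
-- so the tree is regular, and consists of m copies of the layer below, so it has O(m²)
-- clauses. An elimination whose side premises are leaves is an input derivation, and so
-- are the derivations of the C₁: with nothing learned every C₁ becomes learned, and if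
-- the C₁ (resp. C₂) are already learned, taking them as leaves makes every C₂ (resp. the
-- target) learned.
module Submission where

open import Defs
open import Data.Nat using (ℕ; zero; suc; _+_; _*_; _≤_; _<_; z≤n; s≤s; _≟_; _≤?_)
open import Data.Nat.Properties
open import Data.Bool using (Bool; true; false; not) renaming (_≟_ to _≟ᵇ_)
open import Data.Product using (Σ; ∃; _×_; _,_; proj₁; proj₂)
open import Data.Product.Properties using (≡-dec)
open import Data.Sum using (_⊎_; inj₁; inj₂; [_,_]′; map₂) renaming (map to ⊎-map)
open import Data.Unit using (tt)
open import Data.Empty using (⊥)
open import Data.List using ([]; _∷_; _++_; applyUpTo; filter)
open import Data.List.Membership.Propositional using (_∈_; _∉_)
open import Data.List.Membership.Propositional.Properties
  using (∈-++⁺ˡ; ∈-++⁺ʳ; ∈-++⁻; ∈-filter⁺; ∈-filter⁻; ∈-applyUpTo⁺; ∈-applyUpTo⁻)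
open import Data.List.Relation.Unary.Any using (here; there)
open import Data.List.Relation.Unary.All using (All; []; _∷_) renaming (map to All-map; lookup to All-lookup)
open import Data.List.Relation.Unary.All.Properties using (++⁺)
open import Function using (_∘_; const)
open import Relation.Binary.PropositionalEquality
open import Relation.Nullary using (¬_; Dec; yes; no; ¬?; contradiction)
open import Relation.Nullary.Decidable using (recompute)
open import Relation.Nullary.Recomputable using (¬-recompute)
open import Relation.Unary using (_∪_; _⊆_)

pattern ∈₀ = here refl
pattern ∈₁ = there ∈₀
pattern ∈₂ = there ∈₁
pattern ∈₃ = there ∈₂
pattern ∈₄ = there ∈₃
pattern ∈₅ = there ∈₄

All⇒∉ : ∀ {A : Set} {P : A → Set} {xs x} → All P xs → ¬ P x → x ∉ xs
All⇒∉ all ¬Px = ¬Px ∘ All-lookup all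

p-injectiveˡ : ∀ {v w k l} → p v k ≡ p w l → v ≡ w
p-injectiveˡ refl = refl

p-injectiveʳ : ∀ {v w k l} → p v k ≡ p w l → k ≡ l
p-injectiveʳ refl = refl

r-injective : ∀ {k l} → r k ≡ r l → k ≡ l
r-injective refl = refl

_≟ᵛ_ : (x y : Var) → Dec (x ≡ y)
p v k ≟ᵛ p w l with v ≟ w | k ≟ l
... | yes refl | yes refl = yes refl
... | no v≢w   | _        = no (v≢w ∘ p-injectiveˡ)
... | yes _    | no k≢l   = no (k≢l ∘ p-injectiveʳ)
p _ _ ≟ᵛ r _ = no λ ()
r _ ≟ᵛ p _ _ = no λ ()
r k ≟ᵛ r l with k ≟ l
... | yes refl = yes refl
... | no k≢l   = no (k≢l ∘ r-injective)

_≟ˡ_ : (x y : Lit) → Dec (x ≡ y)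
_≟ˡ_ = ≡-dec _≟ᵛ_ _≟ᵇ_

lit-≢ : ∀ {x y : Lit} → proj₁ x ≢ proj₁ y → x ≢ y
lit-≢ x≢y = x≢y ∘ cong proj₁

_without_ : Clause → Lit → Clause
C without l = filter (λ l′ → ¬? (l′ ≟ˡ l)) C

∈-without⁺ : ∀ {C l l′} → l ∈ C → l ≢ l′ → l ∈ C without l′
∈-without⁺ = ∈-filter⁺ (λ l → ¬? (l ≟ˡ _))

∈-without⁻ : ∀ {C l l′} → l ∈ C without l′ → l ∈ C × l ≢ l′
∈-without⁻ = ∈-filter⁻ (λ l → ¬? (l ≟ˡ _))

resolvent : Var → Bool → Clause → Clause → Clause
resolvent v b C D = C without (v , b) ++ D without (v , not b)

isResolvent-resolvent : ∀ v b C D → IsResolvent v b C D (resolvent v b C D)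
isResolvent-resolvent v b C D l =
  ⊎-map ∈-without⁻ ∈-without⁻ ∘ ∈-++⁻ (C without (v , b)) ,
  [ (λ (h , ne) → ∈-++⁺ˡ (∈-without⁺ h ne)) , (λ (h , ne) → ∈-++⁺ʳ _ (∈-without⁺ h ne)) ]′

All⇒IsResolvent : ∀ {v b C D E} →
  All (λ l → (l ∈ C × l ≢ (v , b)) ⊎ (l ∈ D × l ≢ (v , not b))) E →
  All (λ l → l ≢ (v , b) → l ∈ E) C →
  All (λ l → l ≢ (v , not b) → l ∈ E) D →
  IsResolvent v b C D E
All⇒IsResolvent fromE fromC fromD l =
  All-lookup fromE , [ (λ (h , ne) → All-lookup fromC h ne) , (λ (h , ne) → All-lookup fromD h ne) ]′

≋-refl : ∀ {C} → C ≋ C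
≋-refl l = (λ h → h) , (λ h → h)

≋-sym : ∀ {C D} → C ≋ D → D ≋ C
≋-sym e l = proj₂ (e l) , proj₁ (e l)

≋-trans : ∀ {C D E} → C ≋ D → D ≋ E → C ≋ E
≋-trans e f l = proj₁ (f l) ∘ proj₁ (e l) , proj₂ (e l) ∘ proj₂ (f l)

module _ {H : ClauseSet} where

  Deriv-resp-≋ : ∀ {C C′} → C ≋ C′ → Deriv H C → Deriv H C′
  Deriv-resp-≋ e (leaf (C₀ , h , C≋C₀)) = leaf (C₀ , h , ≋-trans (≋-sym e) C≋C₀)
  Deriv-resp-≋ e (res v b d₁ d₂ x y ir) =
    res v b d₁ d₂ x y (λ l → proj₁ (ir l) ∘ proj₂ (e l) , proj₁ (e l) ∘ proj₂ (ir l))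

  module _ {C C′} (e : C ≋ C′) where

    size-resp-≋ : (d : Deriv H C) → size (Deriv-resp-≋ e d) ≡ size d
    size-resp-≋ (leaf _)              = refl
    size-resp-≋ (res _ _ _ _ _ _ _) = refl

    resVars-resp-≋ : (d : Deriv H C) → resVars (Deriv-resp-≋ e d) ≡ resVars d
    resVars-resp-≋ (leaf _)              = refl
    resVars-resp-≋ (res _ _ _ _ _ _ _) = refl

    Regular-resp-≋ : (d : Deriv H C) → Regular d → Regular (Deriv-resp-≋ e d)
    Regular-resp-≋ (leaf _)              reg = reg
    Regular-resp-≋ (res _ _ _ _ _ _ _) reg = reg

    Input-resp-≋ : (d : Deriv H C) → Input d → Input (Deriv-resp-≋ e d)
    Input-resp-≋ (leaf _)              inp = inp
    Input-resp-≋ (res _ _ _ _ _ _ _) inp = inp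

  IsLeaf⇒Input : ∀ {C} (d : Deriv H C) → IsLeaf d → Input d
  IsLeaf⇒Input (leaf _) _ = tt

  infix 4 _⊑_ _⊏_

  data _⊑_ {C} (d : Deriv H C) : ∀ {E} → Deriv H E → Set where
    ⊑-refl  : d ⊑ d
    ⊑-left  : ∀ {D₁ D₂ E v b x y ir} {d₁ : Deriv H D₁} {d₂ : Deriv H D₂} →
              d ⊑ d₁ → d ⊑ res {E = E} v b d₁ d₂ x y ir
    ⊑-right : ∀ {D₁ D₂ E v b x y ir} {d₁ : Deriv H D₁} {d₂ : Deriv H D₂} →
              d ⊑ d₂ → d ⊑ res {E = E} v b d₁ d₂ x y ir

  -- Unlike ⊑, this is preserved by Deriv-resp-≋, which rebuilds only the root.
  _⊏_ : ∀ {C E} → Deriv H C → Deriv H E → Set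
  d ⊏ leaf _                = ⊥
  d ⊏ res _ _ d₁ d₂ _ _ _ = d ⊑ d₁ ⊎ d ⊑ d₂

  ⊏⇒⊑ : ∀ {C E} {d : Deriv H C} {d′ : Deriv H E} → d ⊏ d′ → d ⊑ d′
  ⊏⇒⊑ {d′ = res _ _ _ _ _ _ _} (inj₁ sub) = ⊑-left sub
  ⊏⇒⊑ {d′ = res _ _ _ _ _ _ _} (inj₂ sub) = ⊑-right sub

  ⊏-resp-≋ : ∀ {C E E′} {d : Deriv H C} {d′ : Deriv H E} (e : E ≋ E′) → d ⊏ d′ → d ⊏ Deriv-resp-≋ e d′
  ⊏-resp-≋ {d′ = res _ _ _ _ _ _ _} e sub = sub

  ⊑-trans : ∀ {C D E} {d : Deriv H C} {d′ : Deriv H D} {d″ : Deriv H E} → d ⊑ d′ → d′ ⊑ d″ → d ⊑ d″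
  ⊑-trans sub ⊑-refl        = sub
  ⊑-trans sub (⊑-left sub′)  = ⊑-left (⊑-trans sub sub′)
  ⊑-trans sub (⊑-right sub′) = ⊑-right (⊑-trans sub sub′)

  ⊑⇒inputLemmas-⊆ : ∀ {C E} {d : Deriv H C} {d′ : Deriv H E} → d ⊑ d′ → inputLemmas d ⊆ inputLemmas d′
  ⊑⇒inputLemmas-⊆ ⊑-refl        lemma = lemma
  ⊑⇒inputLemmas-⊆ (⊑-left sub)  lemma = inj₂ (inj₁ (⊑⇒inputLemmas-⊆ sub lemma))
  ⊑⇒inputLemmas-⊆ (⊑-right sub) lemma = inj₂ (inj₂ (⊑⇒inputLemmas-⊆ sub lemma))

  Input⇒inputLemma : ∀ {C} (d : Deriv H C) → Input d → inputLemmas d C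
  Input⇒inputLemma (leaf _)              _   = refl
  Input⇒inputLemma (res _ _ _ _ _ _ _) inp = inj₁ (inp , refl)

  ⊑-Input⇒learned : ∀ {C E} {d : Deriv H C} {d′ : Deriv H E} →
    d ⊑ d′ → Input d → C ∈ₛ (H ∪ₛ inputLemmas d′)
  ⊑-Input⇒learned {d = d} sub inp = _ , inj₂ (⊑⇒inputLemmas-⊆ sub (Input⇒inputLemma d inp)) , ≋-refl

record RegDeriv (H : ClauseSet) (Q : Var → Set) (s : ℕ) (C : Clause) : Set where
  field
    deriv   : Deriv H C
    regular : Regular deriv
    pivots  : All Q (resVars deriv)
    small   : size deriv ≤ s

open RegDeriv

module _ {H : ClauseSet} {Q : Var → Set} where

  leafᴿ : ∀ {s C} → C ∈ₛ H → RegDeriv H Q (suc s) C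
  leafᴿ C∈H = record { deriv = leaf C∈H ; regular = tt ; pivots = [] ; small = s≤s z≤n }

  RegDeriv-resp-≋ : ∀ {s C C′} → C ≋ C′ → RegDeriv H Q s C → RegDeriv H Q s C′
  RegDeriv-resp-≋ {s} e d = record
    { deriv   = Deriv-resp-≋ e (deriv d)
    ; regular = Regular-resp-≋ e (deriv d) (regular d)
    ; pivots  = subst (All Q) (sym (resVars-resp-≋ e (deriv d))) (pivots d)
    ; small   = subst (_≤ s) (sym (size-resp-≋ e (deriv d))) (small d)
    }

  RegDeriv-weaken : ∀ {Q′ s s′ C} → Q ⊆ Q′ → s ≤ s′ → RegDeriv H Q s C → RegDeriv H Q′ s′ C
  RegDeriv-weaken Q⊆Q′ s≤s′ d = record
    { deriv = deriv d ; regular = regular d ; pivots = All-map Q⊆Q′ (pivots d) ; small = ≤-trans (small d) s≤s′ }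

wideClause : ℕ → ℕ → Clause
wideClause v m = applyUpTo (λ k → pos (p v (suc k))) m

StoneVar : ℕ → ℕ → Var → Set
StoneVar v t x = ∃ λ k → 1 ≤ k × k ≤ t × x ≡ p v k

module WideResolution {H : ClauseSet} {Q : Var → Set} {s : ℕ} (v m : ℕ)
  (wide∈H : wideClause v m ∈ₛ H)
  (S : ℕ → Clause)
  (pivot∈S : ∀ x → neg (p v (suc x)) ∈ S x)
  (side : ∀ x → .(x < m) → RegDeriv H Q s (S x))
  (Q∌p : ∀ k → ¬ Q (p v k))
  where

  chain : ℕ → Clause
  chain zero    = wideClause v m
  chain (suc t) = resolvent (p v (suc t)) true (chain t) (S t)

  pos∈chain : ∀ {t k} → t ≤ k → k < m → pos (p v (suc k)) ∈ chain t
  pos∈chain {zero}  _   k<m = ∈-applyUpTo⁺ (λ k → pos (p v (suc k))) k<m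
  pos∈chain {suc t} t<k k<m = proj₂ (isResolvent-resolvent (p v (suc t)) true (chain t) (S t) _)
    (inj₁ (pos∈chain (<⇒≤ t<k) k<m , lit-≢ (<⇒≢ t<k ∘ sym ∘ suc-injective ∘ p-injectiveʳ)))

  ∈-chain⁻ : ∀ t {l} → l ∈ chain t →
    (∃ λ k → t ≤ k × k < m × l ≡ pos (p v (suc k))) ⊎
    (∃ λ x → x < t × l ∈ S x × l ≢ neg (p v (suc x)))
  ∈-chain⁻ zero h with ∈-applyUpTo⁻ _ h
  ... | k , k<m , refl = inj₁ (k , z≤n , k<m , refl)
  ∈-chain⁻ (suc t) {l} h with proj₁ (isResolvent-resolvent (p v (suc t)) true (chain t) (S t) l) h
  ... | inj₂ (h′ , ne) = inj₂ (t , ≤-refl , h′ , ne)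
  ... | inj₁ (h′ , ne) with ∈-chain⁻ t h′
  ...   | inj₂ (x , x<t , h″ , ne′) = inj₂ (x , m≤n⇒m≤1+n x<t , h″ , ne′)
  ...   | inj₁ (k , t≤k , k<m , refl) with m≤n⇒m<n∨m≡n t≤k
  ...     | inj₁ t<k  = inj₁ (k , t<k , k<m , refl)
  ...     | inj₂ refl = contradiction refl ne

  ∈-chain⁺ : ∀ t {l x} → (∀ k → l ≢ pos (p v k)) →
    x < t → l ∈ S x → l ≢ neg (p v (suc x)) → l ∈ chain t
  ∈-chain⁺ (suc t) {l} l≢pos x<1+t h ne with m<1+n⇒m<n∨m≡n x<1+t
  ... | inj₂ refl = proj₂ (isResolvent-resolvent (p v (suc t)) true (chain t) (S t) l) (inj₂ (h , ne))
  ... | inj₁ x<t  = proj₂ (isResolvent-resolvent (p v (suc t)) true (chain t) (S t) l)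
                      (inj₁ (∈-chain⁺ t l≢pos x<t h ne , l≢pos (suc t)))

  ∈-chainₘ⁻ : ∀ {l} → l ∈ chain m → ∃ λ x → x < m × l ∈ S x × l ≢ neg (p v (suc x))
  ∈-chainₘ⁻ h with ∈-chain⁻ m h
  ... | inj₁ (k , m≤k , k<m , _) = contradiction m≤k (<⇒≱ k<m)
  ... | inj₂ found              = found

  chainᴿ : ∀ t → t ≤ m → RegDeriv H (Q ∪ StoneVar v t) (1 + t * suc s) (chain t)
  chainᴿ zero    _   = record { deriv = leaf wide∈H ; regular = tt ; pivots = [] ; small = ≤-refl }
  chainᴿ (suc t) t<m = record
    { deriv   = res (p v (suc t)) true (deriv prev) (deriv next)
                  (pos∈chain ≤-refl t<m) (pivot∈S t) (isResolvent-resolvent _ _ _ _)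
    ; regular = All⇒∉ (pivots prev) [ Q∌p _ , fresh ]′ , All⇒∉ (pivots next) (Q∌p _) ,
                regular prev , regular next
    ; pivots  = inj₂ (suc t , s≤s z≤n , ≤-refl , refl) ∷
                ++⁺ (All-map (map₂ widen) (pivots prev)) (All-map inj₁ (pivots next))
    ; small   = s≤s (≤-trans (+-mono-≤ (small prev) (small next))
                             (≤-reflexive (cong suc (+-comm (t * suc s) s))))
    }
    where
    prev : RegDeriv H (Q ∪ StoneVar v t) (1 + t * suc s) (chain t)
    prev = chainᴿ t (<⇒≤ t<m)
    next : RegDeriv H Q s (S t)
    next = side t t<m
    fresh : ¬ StoneVar v t (p v (suc t))
    fresh (k , _ , k≤t , e) = 1+n≰n (subst (_≤ t) (sym (p-injectiveʳ e)) k≤t)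
    widen : StoneVar v t ⊆ StoneVar v (suc t)
    widen (k , 1≤k , k≤t , e) = k , 1≤k , m≤n⇒m≤1+n k≤t , e

  side⊏chain : ∀ {x t} → x < t → (t≤m : t ≤ m) → .(x<m : x < m) →
    deriv (side x x<m) ⊏ deriv (chainᴿ t t≤m)
  side⊏chain {t = suc t} x<1+t 1+t≤m x<m with m<1+n⇒m<n∨m≡n x<1+t
  ... | inj₂ refl = inj₂ ⊑-refl
  ... | inj₁ x<t  = inj₁ (⊏⇒⊑ (side⊏chain x<t (<⇒≤ 1+t≤m) x<m))

  chain-input : (∀ x .(x<m : x < m) → IsLeaf (deriv (side x x<m))) →
    ∀ t (t≤m : t ≤ m) → Input (deriv (chainᴿ t t≤m))
  chain-input leaves zero    _   = tt
  chain-input leaves (suc t) t<m =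
    inj₂ (leaves t t<m) , chain-input leaves t (<⇒≤ t<m) , IsLeaf⇒Input _ (leaves t t<m)

-- The proof fields are irrelevant so that two stones with the same index are
-- definitionally equal; the relevant versions are recomputed below.
record OtherStone (m j : ℕ) : Set where
  constructor otherStone
  field
    index     : ℕ
    .1≤index  : 1 ≤ index
    .index≤m  : index ≤ m
    .index≢j  : index ≢ j

open OtherStone using (index)

module _ {m j : ℕ} where

  1≤stone : (c : OtherStone m j) → 1 ≤ index c
  1≤stone (otherStone k 1≤k _ _) = recompute (1 ≤? k) 1≤k

  stone≤m : (c : OtherStone m j) → index c ≤ m
  stone≤m (otherStone k _ k≤m _) = recompute (k ≤? m) k≤m

  stone≢j : (c : OtherStone m j) → index c ≢ j
  stone≢j (otherStone _ _ _ k≢j) = ¬-recompute k≢j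

-- From ¬p_{v,j} ∨ r_j and derivations of ¬p_{v,k} ∨ R for all k ≠ j, derive R.  Some
-- k ≠ j must exist (another), or only r_j of R would survive the resolutions.
module Eliminate {H : ClauseSet} {Q : Var → Set} {s : ℕ} (m j v : ℕ) (R : Clause)
  (wide∈H : wideClause v m ∈ₛ H)
  (hyp∈H : (neg (p v j) ∷ pos (r j) ∷ []) ∈ₛ H)
  (rj∈R : pos (r j) ∈ R)
  (R-avoids-v : All (λ l → ∀ k → proj₁ l ≢ p v k) R)
  (another : ∃ λ x → x < m × suc x ≢ j)
  (Q∌p : ∀ k → ¬ Q (p v k))
  (g : (c : OtherStone m j) → RegDeriv H Q (suc s) (neg (p v (index c)) ∷ R))
  where

  column : ∀ x → Dec (suc x ≡ j) → Clause
  column x (yes _) = neg (p v j) ∷ pos (r j) ∷ []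
  column x (no _)  = neg (p v (suc x)) ∷ R

  pivot∈column : ∀ x dec → neg (p v (suc x)) ∈ column x dec
  pivot∈column x (yes eq) = here (cong (neg ∘ p v) eq)
  pivot∈column x (no _)   = ∈₀

  columnᴿ : ∀ x → .(x < m) → (dec : Dec (suc x ≡ j)) → RegDeriv H Q (suc s) (column x dec)
  columnᴿ x _   (yes _) = leafᴿ hyp∈H
  columnᴿ x x<m (no ne) = g (otherStone (suc x) (s≤s z≤n) x<m ne)

  open WideResolution v m wide∈H (λ x → column x (suc x ≟ j)) (λ x → pivot∈column x (suc x ≟ j))
    (λ x x<m → columnᴿ x x<m (suc x ≟ j)) Q∌p

  ∈column⁻ : ∀ {x l} dec → l ∈ column x dec → l ≢ neg (p v (suc x)) → l ∈ R
  ∈column⁻ (yes eq) (here e)        ne = contradiction (trans e (cong (neg ∘ p v) (sym eq))) ne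
  ∈column⁻ (yes _)  (there (here e)) _ = subst (_∈ R) (sym e) rj∈R
  ∈column⁻ (no _)   (here e)        ne = contradiction e ne
  ∈column⁻ (no _)   (there h)       _  = h

  ∈column⁺ : ∀ {x l} dec → suc x ≢ j → l ∈ R → l ∈ column x dec
  ∈column⁺ (yes eq) ne _ = contradiction eq ne
  ∈column⁺ (no _)   _  h = there h

  chain≋R : chain m ≋ R
  chain≋R l = to , from
    where
    to : l ∈ chain m → l ∈ R
    to h with ∈-chainₘ⁻ h
    ... | x , _ , h′ , ne = ∈column⁻ (suc x ≟ j) h′ ne
    from : l ∈ R → l ∈ chain m
    from h = via another
      where
      avoids : ∀ k → proj₁ l ≢ p v k
      avoids = All-lookup R-avoids-v h
      via : (∃ λ x → x < m × suc x ≢ j) → l ∈ chain m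
      via (x , x<m , ne) =
        ∈-chain⁺ m (λ k → lit-≢ (avoids k)) x<m (∈column⁺ (suc x ≟ j) ne h) (lit-≢ (avoids (suc x)))

  eliminate : RegDeriv H (Q ∪ StoneVar v m) (1 + m * suc (suc s)) R
  eliminate = RegDeriv-resp-≋ chain≋R (chainᴿ m ≤-refl)

  g⊏eliminate : ∀ c → deriv (g c) ⊏ deriv eliminate
  g⊏eliminate c@(otherStone zero _ _ _) = contradiction (1≤stone c) λ ()
  g⊏eliminate c@(otherStone (suc x) _ x<m _)
    with suc x ≟ j | side⊏chain {x} (stone≤m c) ≤-refl x<m
  ... | yes eq | _   = contradiction eq (stone≢j c)
  ... | no _   | sub = ⊏-resp-≋ chain≋R sub

  eliminate-input : (∀ c → IsLeaf (deriv (g c))) → Input (deriv eliminate)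
  eliminate-input leaves = Input-resp-≋ chain≋R _ (chain-input column-leaf m ≤-refl)
    where
    column-leaf : ∀ x .(x<m : x < m) → IsLeaf (deriv (columnᴿ x x<m (suc x ≟ j)))
    column-leaf x x<m with suc x ≟ j
    ... | yes _ = tt
    ... | no _  = leaves _

RedVar : ℕ → ℕ → Var → Set
RedVar m j x = ∃ λ k → 1 ≤ k × k ≤ m × k ≢ j × x ≡ r k

size-bound : ∀ {m} → 1 ≤ m → 1 + m * suc (suc (m * 6)) ≤ 9 * (m * m)
size-bound {suc n} _ = subst (1 + suc n * suc (suc (suc n * 6)) ≤_) identity (m≤m+n _ (3 * (n * n) + 4 * n))
  where
  open import Data.Nat.Solver using (module +-*-Solver)
  open +-*-Solver
  identity : 1 + suc n * suc (suc (suc n * 6)) + (3 * (n * n) + 4 * n) ≡ 9 * (suc n * suc n)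
  identity = solve 1 (λ n → con 1 :+ (con 1 :+ n) :* (con 2 :+ (con 1 :+ n) :* con 6)
                              :+ (con 3 :* (n :* n) :+ con 4 :* n)
                         := con 9 :* ((con 1 :+ n) :* (con 1 :+ n))) refl n

module Construction (G : DAG) (m : ℕ) (N≤m : DAG.N G ≤ m)
  (i : ℕ) (1≤i : 1 ≤ i) (i≤n : i ≤ DAG.n G) (j : ℕ) (1≤j : 1 ≤ j) (j≤m : j ≤ m)
  (H : ClauseSet) (Stone⊆H : Stone G m ⊆ H)
  (pred₁-targets : ∀ k → 1 ≤ k → k ≤ m → target G m (DAG.pred₁ G i) k ∈ₛ H)
  (pred₂-targets : ∀ k → 1 ≤ k → k ≤ m → target G m (DAG.pred₂ G i) k ∈ₛ H)
  where
  open DAG G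

  i′ i″ : ℕ
  i′ = pred₁ i
  i″ = pred₂ i

  i<i′ : i < i′
  i<i′ = proj₁ (pred₁-range i 1≤i i≤n)

  i<i″ : i < i″
  i<i″ = proj₁ (pred₂-range i 1≤i i≤n)

  i′≤N : i′ ≤ N
  i′≤N = proj₂ (pred₁-range i 1≤i i≤n)

  i″≤N : i″ ≤ N
  i″≤N = proj₂ (pred₂-range i 1≤i i≤n)

  i′≢i″ : i′ ≢ i″
  i′≢i″ = pred-distinct i 1≤i i≤n

  2≤m : 2 ≤ m
  2≤m = ≤-trans (s≤s 1≤i) (≤-trans i<i′ (≤-trans i′≤N N≤m))

  another-stone : ∃ λ x → x < m × suc x ≢ j
  another-stone with j ≟ 1
  ... | yes j≡1 = 1 , 2≤m , λ 2≡j → 2≢1 (trans 2≡j j≡1)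
    where
    2≢1 : 2 ≢ 1
    2≢1 ()
  ... | no j≢1  = 0 , ≤-trans (s≤s z≤n) 2≤m , j≢1 ∘ sym

  Stone∈ₛH : ∀ {C} → Stone G m C → C ∈ₛ H
  Stone∈ₛH st = _ , Stone⊆H st , ≋-refl

  C₁ : ℕ → ℕ → Clause
  C₁ l k = neg (p i′ l) ∷ neg (p i″ k) ∷ neg (p i j) ∷ pos (r j) ∷ []

  C₂ : ℕ → Clause
  C₂ k = neg (p i″ k) ∷ neg (p i j) ∷ pos (r j) ∷ []

  red : (c : OtherStone m j) → RedVar m j (r (index c))
  red c = index c , 1≤stone c , stone≤m c , stone≢j c , refl

  pebbling∈H : (l k : OtherStone m j) →
    (neg (p i′ (index l)) ∷ neg (r (index l)) ∷ neg (p i″ (index k)) ∷ neg (r (index k))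
      ∷ neg (p i j) ∷ pos (r j) ∷ []) ∈ₛ H
  pebbling∈H l k = Stone∈ₛH (pebbling i (index l) (index k) j 1≤i i≤n
    (1≤stone l) (stone≤m l) (1≤stone k) (stone≤m k) 1≤j j≤m (≢-sym (stone≢j l)) (≢-sym (stone≢j k)))

  i′-target : (c : OtherStone m j) → target G m i′ (index c) ∈ₛ H
  i′-target c = pred₁-targets (index c) (1≤stone c) (stone≤m c)

  i″-target : (c : OtherStone m j) → target G m i″ (index c) ∈ₛ H
  i″-target c = pred₂-targets (index c) (1≤stone c) (stone≤m c)

  C₁-Derivations : Set
  C₁-Derivations = (l k : OtherStone m j) → RegDeriv H (RedVar m j) 5 (C₁ (index l) (index k))

  C₂-Derivations : Set
  C₂-Derivations = (k : OtherStone m j) → RegDeriv H (RedVar m j ∪ StoneVar i′ m) (1 + m * 6) (C₂ (index k))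

  -- Resolve the pebbling clause with ¬p_{i′,l} ∨ r_l and then with ¬p_{i″,k} ∨ r_k;
  -- when l = k the first step already removes both ¬r_l and ¬r_k.
  derive₁ : C₁-Derivations
  derive₁ l k with index l ≟ index k
  ... | yes l≡k = record
    { deriv   = res (r (index l)) false (leaf (pebbling∈H l k)) (leaf (i′-target l)) ∈₁ ∈₁
        (All⇒IsResolvent
          (inj₁ (∈₀ , λ ()) ∷ inj₁ (∈₂ , λ ()) ∷ inj₁ (∈₄ , λ ()) ∷ inj₁ (∈₅ , λ ()) ∷ [])
          (const ∈₀ ∷ contradiction refl ∷ const ∈₁ ∷ contradiction (cong (neg ∘ r) (sym l≡k))
            ∷ const ∈₂ ∷ const ∈₃ ∷ [])
          (const ∈₀ ∷ contradiction refl ∷ []))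
    ; regular = (λ ()) , (λ ()) , tt , tt
    ; pivots  = red l ∷ []
    ; small   = s≤s (s≤s (s≤s z≤n))
    }
  ... | no l≢k = record
    { deriv   = res (r (index k)) false first (leaf (i″-target k)) ∈₂ ∈₁
        (All⇒IsResolvent
          (inj₁ (∈₀ , λ ()) ∷ inj₁ (∈₁ , λ ()) ∷ inj₁ (∈₃ , λ ()) ∷ inj₁ (∈₄ , λ ()) ∷ [])
          (const ∈₀ ∷ const ∈₁ ∷ contradiction refl ∷ const ∈₂ ∷ const ∈₃ ∷ [])
          (const ∈₁ ∷ contradiction refl ∷ []))
    ; regular = (λ { (here e) → l≢k (sym (r-injective e)) ; (there ()) }) , (λ ()) ,
                ((λ ()) , (λ ()) , tt , tt) , tt
    ; pivots  = red k ∷ red l ∷ []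
    ; small   = ≤-refl
    }
    where
    first : Deriv H (neg (p i′ (index l)) ∷ neg (p i″ (index k)) ∷ neg (r (index k))
                       ∷ neg (p i j) ∷ pos (r j) ∷ [])
    first = res (r (index l)) false (leaf (pebbling∈H l k)) (leaf (i′-target l)) ∈₁ ∈₁
      (All⇒IsResolvent
        (inj₁ (∈₀ , λ ()) ∷ inj₁ (∈₂ , λ ()) ∷ inj₁ (∈₃ , lit-≢ (l≢k ∘ sym ∘ r-injective))
          ∷ inj₁ (∈₄ , λ ()) ∷ inj₁ (∈₅ , λ ()) ∷ [])
        (const ∈₀ ∷ contradiction refl ∷ const ∈₁ ∷ const ∈₂ ∷ const ∈₃ ∷ const ∈₄ ∷ [])
        (const ∈₀ ∷ contradiction refl ∷ []))

  derive₁-input : ∀ l k → Input (deriv (derive₁ l k))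
  derive₁-input l k with index l ≟ index k
  ... | yes _ = inj₁ tt , tt , tt
  ... | no _  = inj₂ tt , (inj₁ tt , tt , tt) , tt

  RedVar∌p : ∀ {v} k → ¬ RedVar m j (p v k)
  RedVar∌p _ (_ , _ , _ , _ , ())

  module Level₂ (F : C₁-Derivations) (k : OtherStone m j) =
    Eliminate m j i′ (C₂ (index k)) (Stone∈ₛH (wide i′ (≤-trans 1≤i (<⇒≤ i<i′)) i′≤N))
      (pred₁-targets j 1≤j j≤m) ∈₂
      ((λ _ → i′≢i″ ∘ sym ∘ p-injectiveˡ) ∷ (λ _ → <⇒≢ i<i′ ∘ p-injectiveˡ) ∷ (λ _ ()) ∷ [])
      another-stone RedVar∌p (λ l → F l k)

  Level₂-pivots∌p : ∀ k → ¬ (RedVar m j ∪ StoneVar i′ m) (p i″ k)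
  Level₂-pivots∌p k = [ RedVar∌p k , (λ (_ , _ , _ , e) → i′≢i″ (sym (p-injectiveˡ e))) ]′

  module Level₃ (D : C₂-Derivations) =
    Eliminate m j i″ (target G m i j) (Stone∈ₛH (wide i″ (≤-trans 1≤i (<⇒≤ i<i″)) i″≤N))
      (pred₂-targets j 1≤j j≤m) ∈₁
      ((λ _ → <⇒≢ i<i″ ∘ p-injectiveˡ) ∷ (λ _ ()) ∷ [])
      another-stone Level₂-pivots∌p D

  derive₂ : C₁-Derivations → C₂-Derivations
  derive₂ = Level₂.eliminate

  derive₃ : C₂-Derivations → RegDeriv H (Allowed G m i j) (9 * (m * m)) (target G m i j)
  derive₃ D = RegDeriv-weaken allowed (size-bound (≤-trans (s≤s z≤n) 2≤m)) (Level₃.eliminate D)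
    where
    allowed : (RedVar m j ∪ StoneVar i′ m) ∪ StoneVar i″ m ⊆ Allowed G m i j
    allowed (inj₁ (inj₁ x))                    = inj₁ x
    allowed (inj₁ (inj₂ (k , 1≤k , k≤m , e))) = inj₂ (k , 1≤k , k≤m , inj₁ e)
    allowed (inj₂ (k , 1≤k , k≤m , e))        = inj₂ (k , 1≤k , k≤m , inj₂ e)

  derivation : RegDeriv H (Allowed G m i j) (9 * (m * m)) (target G m i j)
  derivation = derive₃ (derive₂ derive₁)

  learned₁ : KLearned G m (H ∪ₛ inputLemmas (deriv derivation)) 1 i j
  learned₁ l k 1≤l l≤m 1≤k k≤m l≢j k≢j =
    ⊑-Input⇒learned
      (⊑-trans (⊏⇒⊑ (Level₂.g⊏eliminate derive₁ k′ l′)) (⊏⇒⊑ (Level₃.g⊏eliminate (derive₂ derive₁) k′)))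
      (derive₁-input l′ k′)
    where
    l′ k′ : OtherStone m j
    l′ = otherStone l 1≤l l≤m l≢j
    k′ = otherStone k 1≤k k≤m k≢j

  leaves₁ : KLearned G m H 1 i j → C₁-Derivations
  leaves₁ learned l k = leafᴿ (learned (index l) (index k)
    (1≤stone l) (stone≤m l) (1≤stone k) (stone≤m k) (stone≢j l) (stone≢j k))

  learned₂ : (learned : KLearned G m H 1 i j) →
    KLearned G m (H ∪ₛ inputLemmas (deriv (derive₃ (derive₂ (leaves₁ learned))))) 2 i j
  learned₂ learned k 1≤k k≤m k≢j =
    ⊑-Input⇒learned (⊏⇒⊑ (Level₃.g⊏eliminate (derive₂ (leaves₁ learned)) k′))
      (Level₂.eliminate-input (leaves₁ learned) k′ (λ _ → tt))
    where
    k′ : OtherStone m j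
    k′ = otherStone k 1≤k k≤m k≢j

  leaves₂ : KLearned G m H 2 i j → C₂-Derivations
  leaves₂ learned k = leafᴿ (learned (index k) (1≤stone k) (stone≤m k) (stone≢j k))

  learned₃ : (learned : KLearned G m H 2 i j) →
    KLearned G m (H ∪ₛ inputLemmas (deriv (derive₃ (leaves₂ learned)))) 3 i j
  learned₃ learned = ⊑-Input⇒learned ⊑-refl (Level₃.eliminate-input (leaves₂ learned) (λ _ → tt))

  NextLevel : ℕ → Set
  NextLevel K = Σ (Deriv H (target G m i j)) λ d →
    Regular d × size d ≤ 9 * (m * m) × All (Allowed G m i j) (resVars d) ×
    KLearned G m (H ∪ₛ inputLemmas d) (suc K) i j

  certified : ∀ K (d : RegDeriv H (Allowed G m i j) (9 * (m * m)) (target G m i j)) →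
    KLearned G m (H ∪ₛ inputLemmas (deriv d)) (suc K) i j → NextLevel K
  certified _ d learned = deriv d , regular d , small d , pivots d , learned

  next-level : ∀ K → K < 3 → KLearned G m H K i j → NextLevel K
  next-level 0 _ _       = certified 0 derivation learned₁
  next-level 1 _ learned = certified 1 (derive₃ (derive₂ (leaves₁ learned))) (learned₂ learned)
  next-level 2 _ learned = certified 2 (derive₃ (leaves₂ learned)) (learned₃ learned)
  next-level (suc (suc (suc _))) (s≤s (s≤s (s≤s ()))) _

Reachable⇒Stone⊆ : ∀ {G m L} → Reachable G m L → Stone G m ⊆ L
Reachable⇒Stone⊆ initial         st = st
Reachable⇒Stone⊆ (include _ _ R) st = inj₁ (Reachable⇒Stone⊆ R st)

Vertex3Learned⇒targets : ∀ {G m L v} → Reachable G m L → v ≤ DAG.N G → Vertex3Learned G m L v →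
  ∀ k → 1 ≤ k → k ≤ m → target G m v k ∈ₛ L
Vertex3Learned⇒targets R v≤N (inj₁ n<v) k 1≤k k≤m =
  _ , Reachable⇒Stone⊆ R (source _ k n<v v≤N 1≤k k≤m) , ≋-refl
Vertex3Learned⇒targets R v≤N (inj₂ learned) = learned

theorem2p2 :
    (∃ λ c → ∀ (G : DAG) (m : ℕ) → DAG.N G ≤ m →
      ∀ i → 1 ≤ i → i ≤ DAG.n G → ∀ j → 1 ≤ j → j ≤ m →
      Σ (Deriv (Stone G m ∪ₛ PredHyps G m i) (target G m i j)) λ d →
        Regular d × size d ≤ c * (m * m) × All (Allowed G m i j) (resVars d))
    ×
    (∃ λ c → ∀ (G : DAG) (m : ℕ) → DAG.N G ≤ m →
      ∀ i → 1 ≤ i → i ≤ DAG.n G → ∀ j → 1 ≤ j → j ≤ m →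
      ∀ (L : ClauseSet) → Reachable G m L →
      Vertex3Learned G m L (DAG.pred₁ G i) → Vertex3Learned G m L (DAG.pred₂ G i) →
      ∀ K → K < 3 → KLearned G m L K i j →
      Σ (Deriv L (target G m i j)) λ d →
        Regular d × size d ≤ c * (m * m) × All (Allowed G m i j) (resVars d) ×
        KLearned G m (L ∪ₛ inputLemmas d) (suc K) i j)
theorem2p2 =
  (9 , λ G m N≤m i 1≤i i≤n j 1≤j j≤m →
    let open Construction G m N≤m i 1≤i i≤n j 1≤j j≤m (Stone G m ∪ₛ PredHyps G m i) inj₁
               (λ k 1≤k k≤m → _ , inj₂ (k , 1≤k , k≤m , inj₁ refl) , ≋-refl)
               (λ k 1≤k k≤m → _ , inj₂ (k , 1≤k , k≤m , inj₂ refl) , ≋-refl)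
    in deriv derivation , regular derivation , small derivation , pivots derivation) ,
  (9 , λ G m N≤m i 1≤i i≤n j 1≤j j≤m L R i′-learned i″-learned →
    Construction.next-level G m N≤m i 1≤i i≤n j 1≤j j≤m L (Reachable⇒Stone⊆ R)
      (Vertex3Learned⇒targets R (proj₂ (DAG.pred₁-range G i 1≤i i≤n)) i′-learned)
      (Vertex3Learned⇒targets R (proj₂ (DAG.pred₂-range G i 1≤i i≤n)) i″-learned))
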